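{- Let $D$ be a (proper) distribution of pegs on a finite simple graph $G$. Then $\mathrm{Reach}_a(D)=\mathrm{Reach}(D)$.
   Context: A (proper) distribution of pegs on $G$ is a subset $D \subseteq V(G)$. If $u,v \in D$ are distinct adjacent vertices and $w \notin D$ is a vertex adjacent to $v$, the pegging move (jumping $u$ over $v$ into $w$) replaces $D$ by $(D\setminus\{u,v\})\cup\{w\}$. $\mathrm{Reach}(D)$ is the set of vertices $t$ such that some finite (possibly empty) sequence of pegging moves starting from $D$ ends in a distribution containing $t$. Labeled pegs: let $S_G=\{u_i : u\in V(G), i\in\mathbb{Z}\}$ ($u_i$ means peg $i$ sits on vertex $u$). A multi-distribution is a finite subset $M\subseteq S_G$ such that $u_i,v_i\in M$ implies $u=v$ (several pegs may sit on one vertex). Moves on a multi-distribution $M$: (1) stacking move: if $u,v,w$ are distinct vertices, $v$ is adjacent to both $u$ and $w$, and $u_i,v_j\in M$, replace $M$ by $(M\setminus\{u_i,v_j\})\cup\{w_i\}$; (2) pebbling move: if $u,w$ are distinct adjacent vertices, $i\neq j$, and $u_i,u_j\in M$, replace $M$ by $(M\setminus\{u_i,u_j\})\cup\{w_i\}$; (3) removal move: if $u_i\in M$, replace $M$ by $M\setminus\{u_i\}$. A proper distribution is regarded as a multi-distribution by giving its pegs distinct labels. $\mathrm{Reach}_a(D)$ is the set of vertices $t$ such that some finite sequence of stacking, pebbling and removal moves starting from $D$ yields a multi-distribution containing $t_i$ for some $i$. -}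

module Defs where

open import Data.Nat using (ℕ; _<_; _<?_)
open import Data.Nat.Properties using (<-asym)
open import Data.Empty using (⊥-elim)
open import Data.Integer using (ℤ; +_; -[1+_]; ∣_∣)
open import Data.Fin using (Fin; toℕ; fromℕ<)
open import Data.Fin.Subset using (Subset; _∈_; _∉_; _-_; _∪_; ⁅_⁆)
open import Data.Fin.Subset.Properties using (_∈?_)
open import Data.Maybe using (Maybe; just; nothing)
open import Data.Product using (Σ; ∃; ∃-syntax; _×_; _,_)
open import Relation.Nullary using (¬_; yes; no)
open import Relation.Binary.PropositionalEquality using (_≡_; _≢_; refl)
open import Relation.Binary.Construct.Closure.ReflexiveTransitive using (Star)

record SimpleGraph (n : ℕ) : Set₁ where
  field
    Adj    : Fin n → Fin n → Set
    sym    : ∀ {u v} → Adj u v → Adj v u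
    irrefl : ∀ {u} → ¬ Adj u u

module _ {n : ℕ} (G : SimpleGraph n) where
  open SimpleGraph G

  Distribution : Set
  Distribution = Subset n

  PegMove : Distribution → Distribution → Set
  PegMove D D' = ∃[ u ] ∃[ v ] ∃[ w ]
    (u ≢ v × Adj u v × u ∈ D × v ∈ D × w ∉ D × Adj v w
      × D' ≡ ((D - u) - v) ∪ ⁅ w ⁆)

  Reach : Distribution → Fin n → Set
  Reach D t = ∃[ D' ] (Star PegMove D D' × t ∈ D')

  -- Multi-distribution: a finite subset M of S_G = V(G) × ℤ in which each
  -- label i occurs at most once; represented as the partial map
  -- i ↦ (vertex of peg i), with finite support.
  record MultiDist : Set where
    field
      pegAt  : ℤ → Maybe (Fin n)
      finite : ∃[ N ] (∀ i → N < ∣ i ∣ → pegAt i ≡ nothing)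
  open MultiDist public

  StackMove : MultiDist → MultiDist → Set
  StackMove M M' = ∃[ u ] ∃[ v ] ∃[ w ] ∃[ i ] ∃[ j ]
    (u ≢ v × v ≢ w × u ≢ w × Adj u v × Adj v w
      × pegAt M i ≡ just u × pegAt M j ≡ just v
      × pegAt M' i ≡ just w × pegAt M' j ≡ nothing
      × (∀ k → k ≢ i → k ≢ j → pegAt M' k ≡ pegAt M k))

  PebbleMove : MultiDist → MultiDist → Set
  PebbleMove M M' = ∃[ u ] ∃[ w ] ∃[ i ] ∃[ j ]
    (u ≢ w × Adj u w × i ≢ j
      × pegAt M i ≡ just u × pegAt M j ≡ just u
      × pegAt M' i ≡ just w × pegAt M' j ≡ nothing
      × (∀ k → k ≢ i → k ≢ j → pegAt M' k ≡ pegAt M k))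

  RemoveMove : MultiDist → MultiDist → Set
  RemoveMove M M' = ∃[ u ] ∃[ i ]
    (pegAt M i ≡ just u × pegAt M' i ≡ nothing
      × (∀ k → k ≢ i → pegAt M' k ≡ pegAt M k))

  data MultiMove (M M' : MultiDist) : Set where
    stack  : StackMove M M'  → MultiMove M M'
    pebble : PebbleMove M M' → MultiMove M M'
    remove : RemoveMove M M' → MultiMove M M'

  -- A proper distribution regarded as a multi-distribution with distinct
  -- labels: the peg on vertex u gets label toℕ u.
  embedMap : Distribution → ℤ → Maybe (Fin n)
  embedMap D (+ m) with m <? n
  ... | no _ = nothing
  ... | yes p with fromℕ< p ∈? D
  ...   | yes _ = just (fromℕ< p)
  ...   | no _ = nothing
  embedMap D -[1+ _ ] = nothing

  embedMap-finite : (D : Distribution) → ∀ i → n < ∣ i ∣ → embedMap D i ≡ nothing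
  embedMap-finite D (+ m) n<m with m <? n
  ... | no _ = refl
  ... | yes p = ⊥-elim (<-asym n<m p)
  embedMap-finite D -[1+ _ ] _ = refl

  embed : Distribution → MultiDist
  embed D = record { pegAt = embedMap D ; finite = n , embedMap-finite D }

  Reachₐ : Distribution → Fin n → Set
  Reachₐ D t = ∃[ M ] (Star MultiMove (embed D) M × ∃[ i ] (pegAt M i ≡ just t))

-- A pegging move is a stacking move, so labelling each peg by its vertex turns every pegging
-- sequence into a labelled one. Conversely, attach to each labelled peg the set of original pegs
-- it has absorbed: these sets stay pairwise disjoint, and from each of them the vertex of its peg
-- is reachable by pegging moves alone. A stacking or pebbling move merges two such sets, and the
-- union still reaches the new vertex because pegging moves from two disjoint sets can be played
-- together: a jump landing on a peg of the other set is skipped, and that peg stands in for the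
-- jump's two pegs. For pebbling, one of the two pegs on u arrived by jumping over a neighbour of
-- u, which then jumps over u. Finally, reachability is monotone in the starting set.

module Submission where

open import Defs
open import Data.Bool.Base using (if_then_else_)
open import Data.Empty using (⊥; ⊥-elim)
open import Data.Fin using (Fin; toℕ; fromℕ<)
open import Data.Fin.Properties using (toℕ<n; toℕ-fromℕ<; fromℕ<-toℕ) renaming (_≟_ to _≟ᶠ_)
open import Data.Fin.Subset using (Subset; _∈_; _∉_; _⊆_; _─_; _-_; _∪_; ⁅_⁆) renaming (⊥ to ∅)
open import Data.Fin.Subset.Properties
  using ( _∈?_; x∈⁅x⁆; x∈⁅y⁆⇒x≡y; x∉⁅y⁆⇒x≢y; x∈p∪q⁻; x∈p∪q⁺; x∈p∧x≢y⇒x∈p-y; x∈p∧x∉q⇒x∈p─q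
        ; p─q⊆p; ⊆-antisym; ∪-comm)
open import Data.Integer.Base using (ℤ; +_; -[1+_]; ∣_∣)
open import Data.Integer.Properties using () renaming (_≟_ to _≟ᶻ_)
open import Data.Maybe.Base using (Maybe; just; nothing; maybe)
open import Data.Maybe.Properties using (just-injective)
open import Data.Nat.Base using (ℕ; suc; _+_; _<_; _⊔_; s≤s; s≤s⁻¹)
open import Data.Nat.Properties
  using ( _<?_; ≤-refl; ≤-reflexive; ≤-trans; <-≤-trans; +-comm; +-monoˡ-<; m<n⇒m<1+n; n≮n
        ; m⊔n<o⇒m<o; m⊔n<o⇒n<o)
open import Data.Product using (∃-syntax; _×_; _,_; proj₁; proj₂)
open import Data.Sum using (_⊎_; inj₁; inj₂; [_,_]′)
import Data.Sum as Sum
open import Function.Bundles using (_⇔_; mk⇔)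
open import Relation.Nullary using (yes; no; does)
open import Relation.Nullary.Decidable using (dec-true; dec-false)
open import Relation.Binary.PropositionalEquality using (_≡_; _≢_; refl; sym; trans; cong; subst)
open import Relation.Binary.Construct.Closure.ReflexiveTransitive using (Star; ε; _◅_; _◅◅_)

module _ where
  open import Data.Vec.Base using (_∷_; here; there)
  open import Data.Fin.Subset using (inside; outside)

  x∈p─q⇒x∉q : ∀ {n} {x : Fin n} (p q : Subset n) → x ∈ p ─ q → x ∉ q
  x∈p─q⇒x∉q (_ ∷ p) (inside ∷ q) () here
  x∈p─q⇒x∉q (_ ∷ p) (_ ∷ q) (there x∈p─q) (there x∈q) = x∈p─q⇒x∉q p q x∈p─q x∈q

module _ {n : ℕ} where

  private variable
    x y : Fin n
    p q r : Subset n

  Disjoint : Subset n → Subset n → Set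
  Disjoint p q = ∀ {x} → x ∈ p → x ∈ q → ⊥

  Disjoint-sym : Disjoint p q → Disjoint q p
  Disjoint-sym p#q x∈q x∈p = p#q x∈p x∈q

  Disjoint-∪ˡ : Disjoint p r → Disjoint q r → Disjoint (p ∪ q) r
  Disjoint-∪ˡ {p} {q = q} p#r q#r x∈p∪q = [ p#r , q#r ]′ (x∈p∪q⁻ p q x∈p∪q)

  ∪-⊆ : p ⊆ r → q ⊆ r → p ∪ q ⊆ r
  ∪-⊆ {p} {q = q} p⊆r q⊆r x∈p∪q = [ p⊆r , q⊆r ]′ (x∈p∪q⁻ p q x∈p∪q)

  ∈∧∉⇒≢ : x ∈ p → y ∉ p → x ≢ y
  ∈∧∉⇒≢ x∈p y∉p refl = y∉p x∈p

  x∈p-y⁻ : x ∈ p - y → x ∈ p × x ≢ y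
  x∈p-y⁻ {p = p} {y} x∈p-y = p─q⊆p p ⁅ y ⁆ x∈p-y , x∉⁅y⁆⇒x≢y (x∈p─q⇒x∉q p ⁅ y ⁆ x∈p-y)

  p∪[q─p]≡q : p ⊆ q → p ∪ (q ─ p) ≡ q
  p∪[q─p]≡q {p} {q} p⊆q = ⊆-antisym (∪-⊆ p⊆q (p─q⊆p q p)) q⊆p∪[q─p]
    where
      q⊆p∪[q─p] : q ⊆ p ∪ (q ─ p)
      q⊆p∪[q─p] {x} x∈q with x ∈? p
      ... | yes x∈p = x∈p∪q⁺ (inj₁ x∈p)
      ... | no x∉p = x∈p∪q⁺ (inj₂ (x∈p∧x∉q⇒x∈p─q x∈q x∉p))

module _ {n : ℕ} (G : SimpleGraph n) where
  open SimpleGraph G using (Adj; irrefl)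

  private variable
    k m : ℕ
    i j l l′ : ℤ
    t u v w x y : Fin n
    D E P S T X X' Y : Subset n
    M M' : MultiDist G

  jump : Subset n → Fin n → Fin n → Fin n → Subset n
  jump D u v w = ((D - u) - v) ∪ ⁅ w ⁆

  target∈jump : w ∈ jump D u v w
  target∈jump {w = w} = x∈p∪q⁺ (inj₂ (x∈⁅x⁆ w))

  ∈jump⁺ : x ∈ D → x ≢ u → x ≢ v → x ∈ jump D u v w
  ∈jump⁺ x∈D x≢u x≢v = x∈p∪q⁺ (inj₁ (x∈p∧x≢y⇒x∈p-y (x∈p∧x≢y⇒x∈p-y x∈D x≢u) x≢v))

  ∈jump⁻ : x ∈ jump D u v w → x ≡ w ⊎ (x ∈ D × x ≢ u × x ≢ v)
  ∈jump⁻ {D = D} {u} {v} {w} x∈jump with x∈p∪q⁻ ((D - u) - v) ⁅ w ⁆ x∈jump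
  ... | inj₂ x∈⁅w⁆ = inj₁ (x∈⁅y⁆⇒x≡y w x∈⁅w⁆)
  ... | inj₁ x∈D-u-v =
    let (x∈D-u , x≢v) = x∈p-y⁻ x∈D-u-v
        (x∈D , x≢u) = x∈p-y⁻ x∈D-u
    in inj₂ (x∈D , x≢u , x≢v)

  unjump : Subset n → Fin n → Fin n → Fin n → Subset n
  unjump E u v w = (E - w) ∪ (⁅ u ⁆ ∪ ⁅ v ⁆)

  ∈unjump⁺ : x ∈ E → x ≢ w → x ∈ unjump E u v w
  ∈unjump⁺ x∈E x≢w = x∈p∪q⁺ (inj₁ (x∈p∧x≢y⇒x∈p-y x∈E x≢w))

  jumper∈unjump : u ∈ unjump E u v w
  jumper∈unjump {u = u} = x∈p∪q⁺ (inj₂ (x∈p∪q⁺ (inj₁ (x∈⁅x⁆ u))))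

  jumped∈unjump : v ∈ unjump E u v w
  jumped∈unjump {v = v} = x∈p∪q⁺ (inj₂ (x∈p∪q⁺ (inj₂ (x∈⁅x⁆ v))))

  ∈unjump⁻ : x ∈ unjump E u v w → (x ∈ E × x ≢ w) ⊎ x ≡ u ⊎ x ≡ v
  ∈unjump⁻ {E = E} {u} {v} {w} x∈unjump with x∈p∪q⁻ (E - w) _ x∈unjump
  ... | inj₁ x∈E-w = inj₁ (x∈p-y⁻ x∈E-w)
  ... | inj₂ x∈⁅u,v⁆ =
    inj₂ (Sum.map (x∈⁅y⁆⇒x≡y u) (x∈⁅y⁆⇒x≡y v) (x∈p∪q⁻ ⁅ u ⁆ ⁅ v ⁆ x∈⁅u,v⁆))

  jump-∪ : Disjoint X E → u ∈ X → v ∈ X → jump X u v w ∪ E ≡ jump (X ∪ E) u v w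
  jump-∪ {X} {E} {u} {v} {w} X#E u∈X v∈X = ⊆-antisym forth back
    where
      forth : jump X u v w ∪ E ⊆ jump (X ∪ E) u v w
      forth x∈ with x∈p∪q⁻ (jump X u v w) E x∈
      ... | inj₂ x∈E =
        ∈jump⁺ (x∈p∪q⁺ (inj₂ x∈E)) (λ { refl → X#E u∈X x∈E }) (λ { refl → X#E v∈X x∈E })
      ... | inj₁ x∈jump with ∈jump⁻ x∈jump
      ...   | inj₁ refl = target∈jump
      ...   | inj₂ (x∈X , x≢u , x≢v) = ∈jump⁺ (x∈p∪q⁺ (inj₁ x∈X)) x≢u x≢v
      back : jump (X ∪ E) u v w ⊆ jump X u v w ∪ E
      back x∈ with ∈jump⁻ x∈
      ... | inj₁ refl = x∈p∪q⁺ (inj₁ target∈jump)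
      ... | inj₂ (x∈X∪E , x≢u , x≢v) with x∈p∪q⁻ X E x∈X∪E
      ...   | inj₁ x∈X = x∈p∪q⁺ (inj₁ (∈jump⁺ x∈X x≢u x≢v))
      ...   | inj₂ x∈E = x∈p∪q⁺ (inj₂ x∈E)

  jump-disjoint : Disjoint X E → w ∉ E → Disjoint (jump X u v w) E
  jump-disjoint X#E w∉E x∈jump x∈E with ∈jump⁻ x∈jump
  ... | inj₁ refl = w∉E x∈E
  ... | inj₂ (x∈X , _) = X#E x∈X x∈E

  jump∪unjump : u ∈ X → v ∈ X → w ∈ E → jump X u v w ∪ unjump E u v w ≡ X ∪ E
  jump∪unjump {u} {X} {v} {w} {E} u∈X v∈X w∈E = ⊆-antisym forth back
    where
      forth : jump X u v w ∪ unjump E u v w ⊆ X ∪ E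
      forth x∈ with x∈p∪q⁻ (jump X u v w) _ x∈
      ... | inj₁ x∈jump with ∈jump⁻ x∈jump
      ...   | inj₁ refl = x∈p∪q⁺ (inj₂ w∈E)
      ...   | inj₂ (x∈X , _) = x∈p∪q⁺ (inj₁ x∈X)
      forth x∈ | inj₂ x∈unjump with ∈unjump⁻ x∈unjump
      ...   | inj₁ (x∈E , _) = x∈p∪q⁺ (inj₂ x∈E)
      ...   | inj₂ (inj₁ refl) = x∈p∪q⁺ (inj₁ u∈X)
      ...   | inj₂ (inj₂ refl) = x∈p∪q⁺ (inj₁ v∈X)
      back : X ∪ E ⊆ jump X u v w ∪ unjump E u v w
      back {x} x∈ with x∈p∪q⁻ X E x∈
      ... | inj₁ x∈X with x ≟ᶠ u | x ≟ᶠ v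
      ...   | yes refl | _ = x∈p∪q⁺ (inj₂ jumper∈unjump)
      ...   | no _ | yes refl = x∈p∪q⁺ (inj₂ jumped∈unjump)
      ...   | no x≢u | no x≢v = x∈p∪q⁺ (inj₁ (∈jump⁺ x∈X x≢u x≢v))
      back {x} x∈ | inj₂ x∈E with x ≟ᶠ w
      ...   | yes refl = x∈p∪q⁺ (inj₁ target∈jump)
      ...   | no x≢w = x∈p∪q⁺ (inj₂ (∈unjump⁺ x∈E x≢w))

  unjump-disjoint : Disjoint X E → u ∈ X → v ∈ X → w ∉ X
    → Disjoint (jump X u v w) (unjump E u v w)
  unjump-disjoint X#E u∈X v∈X w∉X x∈jump x∈unjump with ∈jump⁻ x∈jump | ∈unjump⁻ x∈unjump
  ... | inj₁ refl | inj₁ (_ , w≢w) = w≢w refl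
  ... | inj₁ refl | inj₂ (inj₁ refl) = w∉X u∈X
  ... | inj₁ refl | inj₂ (inj₂ refl) = w∉X v∈X
  ... | inj₂ (x∈X , _) | inj₁ (x∈E , _) = X#E x∈X x∈E
  ... | inj₂ (_ , x≢u , _) | inj₂ (inj₁ x≡u) = x≢u x≡u
  ... | inj₂ (_ , _ , x≢v) | inj₂ (inj₂ x≡v) = x≢v x≡v

  target∉unjump : u ∈ X → v ∈ X → w ∉ X → w ∉ unjump E u v w
  target∉unjump u∈X v∈X w∉X w∈unjump with ∈unjump⁻ w∈unjump
  ... | inj₁ (_ , w≢w) = w≢w refl
  ... | inj₂ (inj₁ refl) = w∉X u∈X
  ... | inj₂ (inj₂ refl) = w∉X v∈X

  jump-unjump : Disjoint X E → u ∈ X → v ∈ X → w ∈ E → jump (unjump E u v w) u v w ≡ E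
  jump-unjump {X} {E} {u} {v} {w} X#E u∈X v∈X w∈E = ⊆-antisym forth back
    where
      forth : jump (unjump E u v w) u v w ⊆ E
      forth x∈ with ∈jump⁻ x∈
      ... | inj₁ refl = w∈E
      ... | inj₂ (x∈unjump , x≢u , x≢v) with ∈unjump⁻ x∈unjump
      ...   | inj₁ (x∈E , _) = x∈E
      ...   | inj₂ (inj₁ x≡u) = ⊥-elim (x≢u x≡u)
      ...   | inj₂ (inj₂ x≡v) = ⊥-elim (x≢v x≡v)
      back : E ⊆ jump (unjump E u v w) u v w
      back {x} x∈E with x ≟ᶠ w
      ... | yes refl = target∈jump
      ... | no x≢w =
        ∈jump⁺ (∈unjump⁺ x∈E x≢w) (λ { refl → X#E u∈X x∈E }) (λ { refl → X#E v∈X x∈E })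

  infixr 5 _∷_
  infixl 5 _∷ʳ_

  data PegMoves : ℕ → Subset n → Subset n → Set where
    []  : PegMoves 0 D D
    _∷_ : PegMove G D E → PegMoves k E T → PegMoves (suc k) D T

  _++_ : PegMoves k D E → PegMoves m E T → PegMoves (k + m) D T
  [] ++ mvs′ = mvs′
  (mv ∷ mvs) ++ mvs′ = mv ∷ (mvs ++ mvs′)

  _∷ʳ_ : PegMoves k D E → PegMove G E T → PegMoves (suc k) D T
  [] ∷ʳ mv′ = mv′ ∷ []
  (mv ∷ mvs) ∷ʳ mv′ = mv ∷ (mvs ∷ʳ mv′)

  fromStar : Star (PegMove G) D E → ∃[ k ] PegMoves k D E
  fromStar ε = 0 , []
  fromStar (mv ◅ mvs) = let (k , mvs′) = fromStar mvs in suc k , mv ∷ mvs′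

  -- When the target of a move of X holds a bystander from E, the move is skipped and that
  -- bystander is traded for the move's two pegs, which can later jump back onto it.
  data StepBeside (X E X' : Subset n) : Set where
    free    : PegMove G (X ∪ E) (X' ∪ E) → Disjoint X' E → StepBeside X E X'
    blocked : ∀ {E'} → X' ∪ E' ≡ X ∪ E → Disjoint X' E' → PegMove G E' E → StepBeside X E X'

  stepBeside : Disjoint X E → PegMove G X X' → StepBeside X E X'
  stepBeside {X} {E} X#E (u , v , w , u≢v , auv , u∈X , v∈X , w∉X , avw , refl) with w ∈? E
  ... | no w∉E =
    free (u , v , w , u≢v , auv , x∈p∪q⁺ (inj₁ u∈X) , x∈p∪q⁺ (inj₁ v∈X)
             , (λ w∈X∪E → [ w∉X , w∉E ]′ (x∈p∪q⁻ X E w∈X∪E)) , avw , jump-∪ X#E u∈X v∈X)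
         (jump-disjoint X#E w∉E)
  ... | yes w∈E =
    blocked (jump∪unjump u∈X v∈X w∈E) (unjump-disjoint X#E u∈X v∈X w∉X)
            (u , v , w , u≢v , auv , jumper∈unjump , jumped∈unjump , target∉unjump u∈X v∈X w∉X
               , avw , sym (jump-unjump X#E u∈X v∈X w∈E))

  -- s counts the blocked moves: if all k moves were blocked, X ∪ E never changed.
  record Beside (k : ℕ) (X E X' : Subset n) : Set where
    constructor beside
    field
      {E'}     : Subset n
      {s}      : ℕ
      together : Star (PegMove G) (X ∪ E) (X' ∪ E')
      restore  : PegMoves s E' E
      disjoint : Disjoint X' E'
      progress : s < k ⊎ (s ≡ k × X' ∪ E' ≡ X ∪ E)

  movesBeside : Disjoint X E → PegMoves k X X' → Beside k X E X'
  movesBeside X#E [] = beside ε [] X#E (inj₂ (refl , refl))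
  movesBeside X#E (mv ∷ mvs) with stepBeside X#E mv
  ... | free mv' X₁#E with movesBeside X₁#E mvs
  ...   | beside together restore disjoint progress =
    beside (mv' ◅ together) restore disjoint
           (inj₁ ([ m<n⇒m<1+n , (λ { (refl , _) → ≤-refl }) ]′ progress))
  movesBeside X#E (mv ∷ mvs) | blocked X₁∪E₁≡X∪E X₁#E₁ back with movesBeside X₁#E₁ mvs
  ...   | beside together restore disjoint progress =
    beside (subst (λ Z → Star (PegMove G) Z _) X₁∪E₁≡X∪E together) (restore ∷ʳ back) disjoint
           (Sum.map s≤s (λ (s≡k , unchanged) → cong suc s≡k , trans unchanged X₁∪E₁≡X∪E) progress)

  ReachBoth : Subset n → Fin n → Fin n → Set
  ReachBoth S u v = ∃[ P ] (Star (PegMove G) S P × u ∈ P × v ∈ P)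

  -- Run S's moves beside T: either some move of S goes through, and fewer moves are left
  -- in total, or S ∪ T is untouched and already holds u; then do the same with T's moves.
  reachBoth-bounded : ∀ fuel → k + m < fuel → Disjoint S T → PegMoves k S X → PegMoves m T Y
    → u ∈ X → v ∈ Y → ReachBoth (S ∪ T) u v
  reachBoth-bounded {k = k} {m = m} {S = S} {T = T} {u = u} {v = v}
                    (suc fuel) k+m<fuel S#T S→X T→Y u∈X v∈Y
    with movesBeside S#T S→X
  ... | beside S∪T→X∪E E→T X#E (inj₁ s<k) =
    let (P , X∪E→P , u∈P , v∈P) = reachBoth-bounded fuel s+m<fuel X#E [] (E→T ++ T→Y) u∈X v∈Y
    in P , S∪T→X∪E ◅◅ X∪E→P , u∈P , v∈P
    where
      s+m<fuel = <-≤-trans (+-monoˡ-< m s<k) (s≤s⁻¹ k+m<fuel)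
  ... | beside _ _ _ (inj₂ (_ , X∪E≡S∪T)) with movesBeside (Disjoint-sym S#T) T→Y
  ...   | beside T∪S→Y∪F F→S Y#F (inj₁ s<m) =
    let (P , Y∪F→P , v∈P , u∈P) = reachBoth-bounded fuel s+k<fuel Y#F [] (F→S ++ S→X) v∈Y u∈X
    in P , subst (λ Z → Star (PegMove G) Z _) (∪-comm T S) T∪S→Y∪F ◅◅ Y∪F→P , u∈P , v∈P
    where
      s+k<fuel = <-≤-trans (+-monoˡ-< k s<m) (≤-trans (≤-reflexive (+-comm m k)) (s≤s⁻¹ k+m<fuel))
  ...   | beside _ _ _ (inj₂ (_ , Y∪F≡T∪S)) =
    S ∪ T , ε , subst (u ∈_) X∪E≡S∪T (x∈p∪q⁺ (inj₁ u∈X))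
              , subst (v ∈_) (trans Y∪F≡T∪S (∪-comm T S)) (x∈p∪q⁺ (inj₁ v∈Y))

  reachBoth : Disjoint S T → Reach G S u → Reach G T v → ReachBoth (S ∪ T) u v
  reachBoth S#T (X , S→X , u∈X) (Y , T→Y , v∈Y) =
    let (k , S→X′) = fromStar S→X
        (m , T→Y′) = fromStar T→Y
    in reachBoth-bounded (suc (k + m)) ≤-refl S#T S→X′ T→Y′ u∈X v∈Y

  Reach-mono : S ⊆ D → Reach G S x → Reach G D x
  Reach-mono {S} {D} S⊆D (P , S→P , x∈P) with movesBeside S#D─S (proj₂ (fromStar S→P))
    where
      S#D─S : Disjoint S (D ─ S)
      S#D─S x∈S x∈D─S = x∈p─q⇒x∉q D S x∈D─S x∈S
  ... | beside together _ _ _ =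
    _ , subst (λ Z → Star (PegMove G) Z _) (p∪[q─p]≡q S⊆D) together , x∈p∪q⁺ (inj₁ x∈P)

  -- The first peg to arrive at u did so by jumping over a neighbour of u.
  reachableNeighbour : Star (PegMove G) S P → u ∉ S → u ∈ P → ∃[ y ] (Adj y u × Reach G S y)
  reachableNeighbour ε u∉S u∈P = ⊥-elim (u∉S u∈P)
  reachableNeighbour {S} {u = u} (mv@(a , b , w , _ , _ , _ , b∈S , _ , bw , refl) ◅ mvs) u∉S u∈P
    with u ∈? jump S a b w
  ... | no u∉S₁ =
    let (y , yu , (Q , S₁→Q , y∈Q)) = reachableNeighbour mvs u∉S₁ u∈P
    in y , yu , Q , mv ◅ S₁→Q , y∈Q
  ... | yes u∈S₁ with ∈jump⁻ u∈S₁
  ...   | inj₁ refl = b , bw , S , ε , b∈S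
  ...   | inj₂ (u∈S , _) = ⊥-elim (u∉S u∈S)

  Reach-jump : ReachBoth S u v → Adj u v → Adj v w → Reach G S w
  Reach-jump {u = u} {v} {w} (P , S→P , u∈P , v∈P) auv avw with w ∈? P
  ... | yes w∈P = P , S→P , w∈P
  ... | no w∉P =
    jump P u v w , S→P ◅◅ (u-over-v ◅ ε) , target∈jump
    where
      u-over-v : PegMove G P (jump P u v w)
      u-over-v = u , v , w , (λ { refl → irrefl auv }) , auv , u∈P , v∈P , w∉P , avw , refl

  Reach-stack : Disjoint S T → Reach G S u → Reach G T v → Adj u v → Adj v w → Reach G (S ∪ T) w
  Reach-stack S#T S⇝u T⇝v = Reach-jump (reachBoth S#T S⇝u T⇝v)

  Reach-pebble-∉ : Disjoint S T → Reach G S u → Reach G T u → u ∉ T → Adj u w → Reach G (S ∪ T) w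
  Reach-pebble-∉ S#T S⇝u (P , T→P , u∈P) u∉T auw =
    let (y , yu , T⇝y) = reachableNeighbour T→P u∉T u∈P
        (Q , S∪T→Q , u∈Q , y∈Q) = reachBoth S#T S⇝u T⇝y
    in Reach-jump (Q , S∪T→Q , y∈Q , u∈Q) yu auw

  Reach-pebble : Disjoint S T → Reach G S u → Reach G T u → Adj u w → Reach G (S ∪ T) w
  Reach-pebble {S} {T} {u} S#T S⇝u T⇝u auw with u ∈? T
  ... | no u∉T = Reach-pebble-∉ S#T S⇝u T⇝u u∉T auw
  ... | yes u∈T =
    subst (λ Z → Reach G Z _) (∪-comm T S)
          (Reach-pebble-∉ (Disjoint-sym S#T) T⇝u S⇝u (λ u∈S → S#T u∈S u∈T) auw)

  embed-peg⁻ : pegAt (embed G D) i ≡ just x → x ∈ D × i ≡ + toℕ x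
  embed-peg⁻ {D} {+ m} e with m <? n
  ... | yes m<n with fromℕ< m<n ∈? D
  ...   | yes m∈D with refl ← e = m∈D , cong +_ (sym (toℕ-fromℕ< m<n))
  embed-peg⁻ {D} { -[1+ _ ]} ()

  embed-peg⁺ : x ∈ D → pegAt (embed G D) (+ toℕ x) ≡ just x
  embed-peg⁺ {x} {D} x∈D with toℕ x <? n
  ... | no x≮n = ⊥-elim (x≮n (toℕ<n x))
  ... | yes x<n with fromℕ< x<n ∈? D
  ...   | yes _ = cong just (fromℕ<-toℕ x x<n)
  ...   | no x∉D = ⊥-elim (x∉D (subst (_∈ D) (sym (fromℕ<-toℕ x x<n)) x∈D))

  record Relabelled (M M' : MultiDist G) (i j : ℤ) (w : Fin n) : Set where
    constructor relabelled
    field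
      at-i      : pegAt M' i ≡ just w
      at-j      : pegAt M' j ≡ nothing
      elsewhere : ∀ l → l ≢ i → l ≢ j → pegAt M' l ≡ pegAt M l

  Relabelled⁻ : Relabelled M M' i j w → pegAt M' l ≡ just x
    → (l ≡ i × x ≡ w) ⊎ (l ≢ i × l ≢ j × pegAt M l ≡ just x)
  Relabelled⁻ {i = i} {j} {l = l} (relabelled at-i at-j elsewhere) e with l ≟ᶻ i | l ≟ᶻ j
  ... | yes refl | _ = inj₁ (refl , just-injective (trans (sym e) at-i))
  ... | no l≢i | no l≢j = inj₂ (l≢i , l≢j , trans (sym (elsewhere l l≢i l≢j)) e)
  ... | no _ | yes refl with () ← trans (sym at-j) e

  Removed⁻ : RemoveMove G M M' → pegAt M' l ≡ just x → pegAt M l ≡ just x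
  Removed⁻ {l = l} (_ , i , _ , at-i , elsewhere) e with l ≟ᶻ i
  ... | yes refl with () ← trans (sym at-i) e
  ... | no l≢i = trans (sym (elsewhere l l≢i)) e

  record Sourced (D : Subset n) (M : MultiDist G) : Set where
    field
      source   : ℤ → Subset n
      reaches  : pegAt M i ≡ just x → Reach G (source i) x
      disjoint : i ≢ j → pegAt M i ≡ just x → pegAt M j ≡ just y → Disjoint (source i) (source j)
      within   : pegAt M i ≡ just x → source i ⊆ D

  Sourced-embed : ∀ D → Sourced D (embed G D)
  Sourced-embed D = record
    { source   = source
    ; reaches  = λ {i = i} → reaches {i = i}
    ; disjoint = λ {i = i} {j = j} → disjoint {i = i} {j = j}
    ; within   = λ {i = i} → within {i = i}
    }
    where
      source : ℤ → Subset n
      source i = maybe ⁅_⁆ ∅ (embedMap G D i)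
      reaches : embedMap G D i ≡ just x → Reach G (source i) x
      reaches {x = x} e rewrite e = ⁅ x ⁆ , ε , x∈⁅x⁆ x
      disjoint : i ≢ j → embedMap G D i ≡ just x → embedMap G D j ≡ just y
        → Disjoint (source i) (source j)
      disjoint {x = x} {y = y} i≢j ei ej z∈x z∈y rewrite ei | ej
        with refl ← x∈⁅y⁆⇒x≡y x z∈x | refl ← x∈⁅y⁆⇒x≡y y z∈y =
        i≢j (trans (proj₂ (embed-peg⁻ ei)) (sym (proj₂ (embed-peg⁻ ej))))
      within : embedMap G D i ≡ just x → source i ⊆ D
      within {i = i} {x = x} e z∈source rewrite e with refl ← x∈⁅y⁆⇒x≡y x z∈source =
        proj₁ (embed-peg⁻ {i = i} e)

  Sourced-relabel : i ≢ j → pegAt M i ≡ just u → pegAt M j ≡ just v → Relabelled M M' i j w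
    → (∀ {S T} → Disjoint S T → Reach G S u → Reach G T v → Reach G (S ∪ T) w)
    → Sourced D M → Sourced D M'
  Sourced-relabel {i} {j} {M} {u} {v} {M'} {w} {D} i≢j ei ej rel combine σ = record
    { source   = merged
    ; reaches  = reaches′
    ; disjoint = disjoint′
    ; within   = within′
    }
    where
      open Sourced σ
      merged : ℤ → Subset n
      merged l = if does (l ≟ᶻ i) then source i ∪ source j else source l

      merged-i : merged i ≡ source i ∪ source j
      merged-i rewrite dec-true (i ≟ᶻ i) refl = refl

      merged-≢ : l ≢ i → merged l ≡ source l
      merged-≢ {l} l≢i rewrite dec-false (l ≟ᶻ i) l≢i = refl

      reaches′ : pegAt M' l ≡ just x → Reach G (merged l) x
      reaches′ e with Relabelled⁻ rel e
      ... | inj₁ (refl , refl) rewrite merged-i =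
        combine (disjoint i≢j ei ej) (reaches ei) (reaches ej)
      ... | inj₂ (l≢i , _ , e₀) rewrite merged-≢ l≢i = reaches e₀

      i#other : l ≢ i → l ≢ j → pegAt M l ≡ just x → Disjoint (merged i) (merged l)
      i#other l≢i l≢j e rewrite merged-i | merged-≢ l≢i =
        Disjoint-∪ˡ (disjoint (λ { refl → l≢i refl }) ei e) (disjoint (λ { refl → l≢j refl }) ej e)

      disjoint′ : l ≢ l′ → pegAt M' l ≡ just x → pegAt M' l′ ≡ just y
        → Disjoint (merged l) (merged l′)
      disjoint′ l≢l′ e e′ with Relabelled⁻ rel e | Relabelled⁻ rel e′
      ... | inj₁ (refl , _) | inj₁ (refl , _) = ⊥-elim (l≢l′ refl)
      ... | inj₁ (refl , _) | inj₂ (l′≢i , l′≢j , e₀′) = i#other l′≢i l′≢j e₀′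
      ... | inj₂ (l≢i , l≢j , e₀) | inj₁ (refl , _) = Disjoint-sym (i#other l≢i l≢j e₀)
      ... | inj₂ (l≢i , _ , e₀) | inj₂ (l′≢i , _ , e₀′)
        rewrite merged-≢ l≢i | merged-≢ l′≢i = disjoint l≢l′ e₀ e₀′

      within′ : pegAt M' l ≡ just x → merged l ⊆ D
      within′ e with Relabelled⁻ rel e
      ... | inj₁ (refl , _) rewrite merged-i = ∪-⊆ (within ei) (within ej)
      ... | inj₂ (l≢i , _ , e₀) rewrite merged-≢ l≢i = within e₀

  Sourced-remove : RemoveMove G M M' → Sourced D M → Sourced D M'
  Sourced-remove {M} {M'} mv σ = record
    { source   = source
    ; reaches  = λ e → reaches (earlier e)
    ; disjoint = λ i≢j ei ej → disjoint i≢j (earlier ei) (earlier ej)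
    ; within   = λ e → within (earlier e)
    }
    where
      open Sourced σ
      earlier : pegAt M' l ≡ just x → pegAt M l ≡ just x
      earlier = Removed⁻ {M = M} {M' = M'} mv

  Sourced-move : MultiMove G M M' → Sourced D M → Sourced D M'
  Sourced-move (stack (u , v , w , i , j , u≢v , _ , _ , auv , avw , ei , ej , at-i , at-j , elsewhere)) =
    Sourced-relabel (λ { refl → u≢v (just-injective (trans (sym ei) ej)) }) ei ej
                    (relabelled at-i at-j elsewhere) (λ S#T S⇝u T⇝v → Reach-stack S#T S⇝u T⇝v auv avw)
  Sourced-move (pebble (u , w , i , j , _ , auw , i≢j , ei , ej , at-i , at-j , elsewhere)) =
    Sourced-relabel i≢j ei ej
                    (relabelled at-i at-j elsewhere) (λ S#T S⇝u T⇝u → Reach-pebble S#T S⇝u T⇝u auw)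
  Sourced-move (remove mv) = Sourced-remove mv

  Sourced-moves : Star (MultiMove G) M M' → Sourced D M → Sourced D M'
  Sourced-moves ε σ = σ
  Sourced-moves (mv ◅ mvs) σ = Sourced-moves mvs (Sourced-move mv σ)

  Reachₐ⇒Reach : Reachₐ G D t → Reach G D t
  Reachₐ⇒Reach {D} (M , moves , i , e) = Reach-mono (within e) (reaches e)
    where open Sourced (Sourced-moves moves (Sourced-embed D))

  relabelAt : MultiDist G → ℤ → ℤ → Fin n → ℤ → Maybe (Fin n)
  relabelAt M i j w l =
    if does (l ≟ᶻ i) then just w else if does (l ≟ᶻ j) then nothing else pegAt M l

  relabelAt-finite : ∀ l → proj₁ (finite M) ⊔ ∣ i ∣ < ∣ l ∣ → relabelAt M i j w l ≡ nothing
  relabelAt-finite {M} {i} {j} l N⊔i<l with l ≟ᶻ i | l ≟ᶻ j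
  ... | yes refl | _ = ⊥-elim (n≮n _ (m⊔n<o⇒n<o (proj₁ (finite M)) ∣ i ∣ N⊔i<l))
  ... | no _ | yes _ = refl
  ... | no _ | no _ = proj₂ (finite M) l (m⊔n<o⇒m<o _ ∣ i ∣ N⊔i<l)

  relabel : MultiDist G → ℤ → ℤ → Fin n → MultiDist G
  relabel M i j w = record
    { pegAt  = relabelAt M i j w
    ; finite = proj₁ (finite M) ⊔ ∣ i ∣ , relabelAt-finite {M = M} {i = i} {j = j} {w = w}
    }

  relabel-Relabelled : i ≢ j → Relabelled M (relabel M i j w) i j w
  relabel-Relabelled {i = i} {j = j} {M = M} {w = w} i≢j = relabelled at-i at-j elsewhere
    where
      at-i : relabelAt M i j w i ≡ just w
      at-i rewrite dec-true (i ≟ᶻ i) refl = refl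
      at-j : relabelAt M i j w j ≡ nothing
      at-j rewrite dec-false (j ≟ᶻ i) (λ j≡i → i≢j (sym j≡i)) | dec-true (j ≟ᶻ j) refl = refl
      elsewhere : ∀ l → l ≢ i → l ≢ j → relabelAt M i j w l ≡ pegAt M l
      elsewhere l l≢i l≢j rewrite dec-false (l ≟ᶻ i) l≢i | dec-false (l ≟ᶻ j) l≢j = refl

  record Tracks (M : MultiDist G) (P : Subset n) : Set where
    field
      pegOn  : x ∈ P → ∃[ i ] pegAt M i ≡ just x
      onlyOn : pegAt M i ≡ just x → x ∈ P
      unique : pegAt M i ≡ just x → pegAt M j ≡ just x → i ≡ j

  Tracks-embed : ∀ D → Tracks (embed G D) D
  Tracks-embed D = record
    { pegOn  = λ {x} x∈D → + toℕ x , embed-peg⁺ x∈D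
    ; onlyOn = λ {i = i} e → proj₁ (embed-peg⁻ {i = i} e)
    ; unique = λ {i = i} {j = j} ei ej →
        trans (proj₂ (embed-peg⁻ {i = i} ei)) (sym (proj₂ (embed-peg⁻ {i = j} ej)))
    }

  Tracks-relabel : Tracks M P → pegAt M i ≡ just u → pegAt M j ≡ just v → Relabelled M M' i j w → w ∉ P
    → Tracks M' (jump P u v w)
  Tracks-relabel {M} {P} {i} {u} {j} {v} {M'} {w} τ ei ej rel w∉P =
    record { pegOn = pegOn′ ; onlyOn = onlyOn′ ; unique = unique′ }
    where
      open Tracks τ
      open Relabelled rel

      pegOn′ : x ∈ jump P u v w → ∃[ l ] pegAt M' l ≡ just x
      pegOn′ x∈ with ∈jump⁻ x∈
      ... | inj₁ refl = i , at-i
      ... | inj₂ (x∈P , x≢u , x≢v) =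
        let (l , el) = pegOn x∈P
            l≢i = λ { refl → x≢u (just-injective (trans (sym el) ei)) }
            l≢j = λ { refl → x≢v (just-injective (trans (sym el) ej)) }
        in l , trans (elsewhere l l≢i l≢j) el

      onlyOn′ : pegAt M' l ≡ just x → x ∈ jump P u v w
      onlyOn′ e with Relabelled⁻ rel e
      ... | inj₁ (_ , refl) = target∈jump
      ... | inj₂ (l≢i , l≢j , e₀) =
        ∈jump⁺ (onlyOn e₀) (λ { refl → l≢i (unique e₀ ei) }) (λ { refl → l≢j (unique e₀ ej) })

      unique′ : pegAt M' l ≡ just x → pegAt M' l′ ≡ just x → l ≡ l′
      unique′ e e′ with Relabelled⁻ rel e | Relabelled⁻ rel e′
      ... | inj₁ (refl , _) | inj₁ (refl , _) = refl
      ... | inj₁ (_ , refl) | inj₂ (_ , _ , e₀′) = ⊥-elim (w∉P (onlyOn e₀′))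
      ... | inj₂ (_ , _ , e₀) | inj₁ (_ , refl) = ⊥-elim (w∉P (onlyOn e₀))
      ... | inj₂ (_ , _ , e₀) | inj₂ (_ , _ , e₀′) = unique e₀ e₀′

  Tracks-move : Tracks M P → PegMove G P X → ∃[ M' ] (MultiMove G M M' × Tracks M' X)
  Tracks-move {M} τ (u , v , w , u≢v , auv , u∈P , v∈P , w∉P , avw , refl)
    with Tracks.pegOn τ u∈P | Tracks.pegOn τ v∈P
  ... | i , ei | j , ej =
    relabel M i j w
    , stack ( u , v , w , i , j , u≢v , ∈∧∉⇒≢ v∈P w∉P , ∈∧∉⇒≢ u∈P w∉P , auv , avw , ei , ej
            , at-i , at-j , elsewhere)
    , Tracks-relabel τ ei ej rel w∉P
    where
      rel : Relabelled M (relabel M i j w) i j w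
      rel = relabel-Relabelled λ { refl → u≢v (just-injective (trans (sym ei) ej)) }
      open Relabelled rel

  Tracks-moves : Tracks M P → Star (PegMove G) P X → ∃[ M' ] (Star (MultiMove G) M M' × Tracks M' X)
  Tracks-moves {M} τ ε = M , ε , τ
  Tracks-moves τ (mv ◅ mvs) =
    let (M₁ , mv′ , τ₁) = Tracks-move τ mv
        (M₂ , mvs′ , τ₂) = Tracks-moves τ₁ mvs
    in M₂ , mv′ ◅ mvs′ , τ₂

  Reach⇒Reachₐ : Reach G D t → Reachₐ G D t
  Reach⇒Reachₐ {D} (P , moves , t∈P) =
    let (M , moves′ , τ) = Tracks-moves (Tracks-embed D) moves
    in M , moves′ , Tracks.pegOn τ t∈P

theorem2p5 : {n : ℕ} (G : SimpleGraph n) (D : Distribution G)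
    → (t : Fin n) → Reachₐ G D t ⇔ Reach G D t
theorem2p5 G D t = mk⇔ (Reachₐ⇒Reach G) (Reach⇒Reachₐ G)
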